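{- Let $a,b,k$ be integers with $k\ge b>a\ge 1$. The set $\mathcal{D}'_{a,b,k}$ of partitions $(\pi_1,\dots,\pi_\ell)$ with all parts congruent to $a$ or $b$ modulo $k$ and with $\pi_i-\pi_{i+1}\ge k$ for $1\le i<\ell$, strict inequality if $\pi_i\equiv a\pmod k$, is a separable integer partition class with modulus $k$.
   Context: A partition is a finite non-increasing sequence of positive integers. For a positive integer $k$, a set $\mathcal{P}$ of partitions is a separable integer partition class with modulus $k$ if there is a subset $\mathcal{B}\subset\mathcal{P}$ (the basis) such that for each integer $m\ge1$ the number of partitions in $\mathcal{B}$ with $m$ parts is finite, every partition in $\mathcal{P}$ with $m$ parts is uniquely of the form $(b_1+\pi_1,\dots,b_m+\pi_m)$ where $(b_1,\dots,b_m)\in\mathcal{B}$ and $(\pi_1,\dots,\pi_m)$ is a non-increasing sequence of nonnegative integers each divisible by $k$, and all partitions of this form lie in $\mathcal{P}$. -}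

module Defs where

open import Data.Nat using (ℕ; _+_; _≤_; _<_; _≥_; ∣_-_∣)
open import Data.Nat.Divisibility using (_∣_)
open import Data.List using (List; length; zipWith)
open import Data.List.Relation.Unary.All using (All)
open import Data.List.Relation.Unary.Linked using (Linked)
open import Data.List.Membership.Propositional using (_∈_)
open import Data.Product using (Σ; _×_)
open import Data.Sum using (_⊎_)
open import Relation.Binary.PropositionalEquality using (_≡_)

_≡_[mod_] : ℕ → ℕ → ℕ → Set
x ≡ y [mod k ] = k ∣ ∣ x - y ∣

IsPartition : List ℕ → Set
IsPartition ps = Linked _≥_ ps × All (λ x → 1 ≤ x) ps

KMultSeq : ℕ → List ℕ → Set
KMultSeq k πs = Linked _≥_ πs × All (λ x → k ∣ x) πs

record SeparableClass (k : ℕ) (P : List ℕ → Set) : Set₁ where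
  field
    Basis : List ℕ → Set
    Basis⊆P : ∀ bs → Basis bs → P bs
    finite : ∀ m → 1 ≤ m →
      Σ (List (List ℕ)) λ L → ∀ bs → Basis bs → length bs ≡ m → bs ∈ L
    decompose : ∀ ps → P ps → 1 ≤ length ps →
      Σ (List ℕ) λ bs → Σ (List ℕ) λ πs →
        Basis bs × KMultSeq k πs × length bs ≡ length ps ×
        length πs ≡ length ps × ps ≡ zipWith _+_ bs πs
    unique : ∀ bs πs bs′ πs′ → Basis bs → Basis bs′ →
      KMultSeq k πs → KMultSeq k πs′ → 1 ≤ length bs →
      length πs ≡ length bs → length bs′ ≡ length bs → length πs′ ≡ length bs →
      zipWith _+_ bs πs ≡ zipWith _+_ bs′ πs′ → bs ≡ bs′ × πs ≡ πs′
    closed : ∀ bs πs → Basis bs → KMultSeq k πs → 1 ≤ length bs →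
      length πs ≡ length bs → P (zipWith _+_ bs πs)

DGap : ℕ → ℕ → ℕ → ℕ → Set
DGap a k x y = (k + y ≤ x) × (x ≡ a [mod k ] → k + y < x)

D′ : ℕ → ℕ → ℕ → List ℕ → Set
D′ a b k ps =
  IsPartition ps ×
  All (λ x → (x ≡ a [mod k ]) ⊎ (x ≡ b [mod k ])) ps ×
  Linked (DGap a k) ps

{-# OPTIONS --safe #-}
module Submission where

-- Because 1 ≤ a < b ≤ k, every part of a partition in D′ is uniquely a + q k or
-- b + q k: a tag (a or b) together with a level q.  The difference condition
-- between consecutive parts says exactly that the level drops by at least 2
-- after an a-part and by at least 1 after a b-part.  For a fixed tag word the
-- basis partition is the one in which every drop is minimal and the last level
-- is 0; subtracting its levels from those of any partition with the same tags
-- leaves a non-increasing sequence t, and the partition is the basis plus k t.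

open import Defs
open import Data.Nat
  using (ℕ; zero; suc; _+_; _*_; _∸_; _≤_; _<_; _≥_; NonZero; >-nonZero)
open import Data.Nat.Properties
open import Data.Nat.Divisibility using (_∣_; divides; n∣m*n)
open import Algebra.Properties.CommutativeSemigroup +-commutativeSemigroup using (x∙yz≈y∙xz)
open import Data.List
  using (List; []; _∷_; length; zipWith; map; replicate; cartesianProductWith)
open import Data.List.Properties using (∷-injectiveˡ; ∷-injectiveʳ; length-map)
open import Data.List.Relation.Unary.All as All using (All; []; _∷_)
open import Data.List.Relation.Unary.All.Properties as All using ()
open import Data.List.Relation.Unary.Any using (here; there)
open import Data.List.Relation.Unary.Linked as Linked using (Linked; []; [-]; _∷_)
import Data.List.Relation.Unary.Linked.Properties as Linked
open import Data.List.Membership.Propositional using (_∈_)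
open import Data.List.Membership.Propositional.Properties
  using (∈-map⁺; ∈-cartesianProductWith⁺)
open import Data.Product using (Σ; ∃-syntax; ∃₂; _×_; _,_; proj₁; proj₂)
open import Data.Sum using (_⊎_; inj₁; inj₂)
open import Relation.Nullary using (contradiction)
open import Relation.Binary.Definitions using (tri<; tri≈; tri>)
open import Relation.Binary.PropositionalEquality
  using (_≡_; refl; sym; trans; cong; cong₂; subst; subst₂; module ≡-Reasoning)

+*≡[mod] : ∀ v q k → (v + q * k) ≡ v [mod k ]
+*≡[mod] v q k =
  subst (k ∣_) (sym (trans (∣-∣-comm (v + q * k) v) (∣m-m+n∣≡n v (q * k)))) (n∣m*n q)

≡[mod]⇒+* : ∀ {v x k} → v ≤ k → 0 < x → x ≡ v [mod k ] → ∃[ q ] x ≡ v + q * k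
≡[mod]⇒+* {v} {x} {k} v≤k 0<x (divides q ∣x-v∣≡q*k) with ≤-total v x
... | inj₁ v≤x = q , (begin
  x            ≡⟨ m+[n∸m]≡n v≤x ⟨
  v + (x ∸ v)  ≡⟨ cong (v +_) (trans (sym (m≤n⇒∣n-m∣≡n∸m v≤x)) ∣x-v∣≡q*k) ⟩
  v + q * k    ∎)
  where open ≡-Reasoning
... | inj₂ x≤v =
  0 , trans (x≡v q (trans (sym (m≤n⇒∣m-n∣≡n∸m x≤v)) ∣x-v∣≡q*k)) (sym (+-identityʳ v))
  where
  x≡v : ∀ q → v ∸ x ≡ q * k → x ≡ v
  x≡v zero    v∸x≡0     = ≤-antisym x≤v (m∸n≡0⇒m≤n v∸x≡0)
  x≡v (suc p) v∸x≡k+p*k = contradiction k<k (<-irrefl refl)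
    where
    open ≤-Reasoning
    k<k : k < k
    k<k = begin-strict
      k          ≤⟨ m≤m+n k (p * k) ⟩
      k + p * k  ≡⟨ v∸x≡k+p*k ⟨
      v ∸ x      <⟨ ∸-monoʳ-< 0<x x≤v ⟩
      v          ≤⟨ v≤k ⟩
      k          ∎

+*-mono-< : ∀ {u v k m n} → u ≤ k → 0 < v → m < n → u + m * k < v + n * k
+*-mono-< {u} {v} {k} {m} {n} u≤k 0<v m<n = begin-strict
  u + m * k  ≤⟨ +-monoˡ-≤ (m * k) u≤k ⟩
  suc m * k  ≤⟨ *-monoˡ-≤ k m<n ⟩
  n * k      <⟨ m<n+m (n * k) 0<v ⟩
  v + n * k  ∎
  where open ≤-Reasoning

+*-injective : ∀ {u v k m n} → 0 < u → 0 < v → u ≤ k → v ≤ k →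
  u + m * k ≡ v + n * k → u ≡ v × m ≡ n
+*-injective {u} {v} {k} {m} {n} 0<u 0<v u≤k v≤k eq with <-cmp m n
... | tri< m<n _ _ = contradiction eq (<⇒≢ (+*-mono-< u≤k 0<v m<n))
... | tri> _ _ n<m = contradiction (sym eq) (<⇒≢ (+*-mono-< v≤k 0<u n<m))
... | tri≈ _ refl _ = +-cancelʳ-≡ (m * k) u v eq , refl

All∣⇒multiples : ∀ {k πs} → All (k ∣_) πs → ∃[ ts ] πs ≡ map (_* k) ts
All∣⇒multiples []                        = [] , refl
All∣⇒multiples (divides t refl ∷ k∣πs) with All∣⇒multiples k∣πs
... | ts , refl = t ∷ ts , refl

KMultSeq⇒multiples : ∀ {k πs} .{{_ : NonZero k}} → KMultSeq k πs →
  ∃[ ts ] πs ≡ map (_* k) ts × Linked _≥_ ts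
KMultSeq⇒multiples {k} (≥πs , k∣πs) with All∣⇒multiples k∣πs
... | ts , refl = ts , refl , Linked.map (*-cancelʳ-≤ _ _ k) (Linked.map⁻ ≥πs)

multiples⇒KMultSeq : ∀ {k ts} → Linked _≥_ ts → KMultSeq k (map (_* k) ts)
multiples⇒KMultSeq {k} {ts} ≥ts =
  Linked.map⁺ (Linked.map (*-monoˡ-≤ k) ≥ts) ,
  All.map⁺ (All.universal (λ t → n∣m*n t) ts)

zeros-≥ : ∀ n → Linked _≥_ (replicate n 0)
zeros-≥ zero          = []
zeros-≥ (suc zero)    = [-]
zeros-≥ (suc (suc n)) = ≤-refl ∷ zeros-≥ (suc n)

data Tag : Set where
  A B : Tag

tagLists : ℕ → List (List Tag)
tagLists zero    = [] ∷ []
tagLists (suc n) = cartesianProductWith _∷_ (A ∷ B ∷ []) (tagLists n)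

∈-tagLists : ∀ {n rs} → length rs ≡ n → rs ∈ tagLists n
∈-tagLists {rs = []}     refl = here refl
∈-tagLists {rs = r ∷ rs} refl = ∈-cartesianProductWith⁺ _∷_ (∈-tags r) (∈-tagLists refl)
  where
  ∈-tags : ∀ r → r ∈ A ∷ B ∷ []
  ∈-tags A = here refl
  ∈-tags B = there (here refl)

module SeparableD′ {a b k : ℕ} (1≤a : 1 ≤ a) (a<b : a < b) (b≤k : b ≤ k) where

  private instance
    k-nonZero : NonZero k
    k-nonZero = >-nonZero (<-≤-trans (<-trans 1≤a a<b) b≤k)

  residue : Tag → ℕ
  residue A = a
  residue B = b

  residue-positive : ∀ r → 0 < residue r
  residue-positive A = 1≤a
  residue-positive B = <-trans 1≤a a<b

  a≤residue : ∀ r → a ≤ residue r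
  a≤residue A = ≤-refl
  a≤residue B = <⇒≤ a<b

  residue≤b : ∀ r → residue r ≤ b
  residue≤b A = <⇒≤ a<b
  residue≤b B = ≤-refl

  residue≤k : ∀ r → residue r ≤ k
  residue≤k r = ≤-trans (residue≤b r) b≤k

  residue-injective : ∀ r r′ → residue r ≡ residue r′ → r ≡ r′
  residue-injective A A _   = refl
  residue-injective A B a≡b = contradiction a≡b (<⇒≢ a<b)
  residue-injective B A b≡a = contradiction (sym b≡a) (<⇒≢ a<b)
  residue-injective B B _   = refl

  part : Tag → ℕ → ℕ
  part r q = residue r + q * k

  part-positive : ∀ r q → 0 < part r q
  part-positive r q = ≤-trans (residue-positive r) (m≤m+n (residue r) (q * k))

  part-+ : ∀ r q t → part r q + t * k ≡ part r (q + t)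
  part-+ r q t = begin
    residue r + q * k + t * k    ≡⟨ +-assoc (residue r) (q * k) (t * k) ⟩
    residue r + (q * k + t * k)  ≡⟨ cong (residue r +_) (*-distribʳ-+ k q t) ⟨
    residue r + (q + t) * k      ∎
    where open ≡-Reasoning

  part-injective : ∀ r r′ q q′ → part r q ≡ part r′ q′ → r ≡ r′ × q ≡ q′
  part-injective r r′ _ _ eq
    with +*-injective (residue-positive r) (residue-positive r′)
                      (residue≤k r) (residue≤k r′) eq
  ... | same-residue , q≡q′ = residue-injective r r′ same-residue , q≡q′

  IsPart : ℕ → Set
  IsPart x = ∃₂ λ r q → x ≡ part r q

  part-≡residue : ∀ r q → part r q ≡ residue r [mod k ]
  part-≡residue r q = +*≡[mod] (residue r) q k

  ≡residue⇒IsPart : ∀ {x} r → 0 < x → x ≡ residue r [mod k ] → IsPart x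
  ≡residue⇒IsPart r 0<x x≡r with ≡[mod]⇒+* (residue≤k r) 0<x x≡r
  ... | q , x≡part = r , q , x≡part

  part-≡residue⇒tag : ∀ r q r′ → part r q ≡ residue r′ [mod k ] → r ≡ r′
  part-≡residue⇒tag r q r′ ≡r′ with ≡[mod]⇒+* (residue≤k r′) (part-positive r q) ≡r′
  ... | q′ , same-part = proj₁ (part-injective r r′ q q′ same-part)

  minDrop : Tag → ℕ
  minDrop A = 2
  minDrop B = 1

  descends⇒DGap : ∀ r r′ {q q′} → minDrop r + q′ ≤ q → DGap a k (part r q) (part r′ q′)
  descends⇒DGap A r′ {q} {q′} 2+q′≤q = <⇒≤ k+y<x , λ _ → k+y<x
    where
    open ≤-Reasoning
    k+y<x : k + part r′ q′ < part A q
    k+y<x = begin-strict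
      k + (residue r′ + q′ * k)  ≤⟨ +-monoʳ-≤ k (+-monoˡ-≤ (q′ * k) (residue≤k r′)) ⟩
      (2 + q′) * k               <⟨ m<n+m _ 1≤a ⟩
      a + (2 + q′) * k           ≤⟨ +-monoʳ-≤ a (*-monoˡ-≤ k 2+q′≤q) ⟩
      a + q * k                  ∎
  descends⇒DGap B r′ {q} {q′} 1+q′≤q =
    k+y≤x , λ x≡a → contradiction (part-≡residue⇒tag B q A x≡a) λ ()
    where
    open ≤-Reasoning
    k+y≤x : k + part r′ q′ ≤ part B q
    k+y≤x = begin
      k + (residue r′ + q′ * k)  ≡⟨ x∙yz≈y∙xz k (residue r′) (q′ * k) ⟩
      residue r′ + (1 + q′) * k  ≤⟨ +-monoˡ-≤ ((1 + q′) * k) (residue≤b r′) ⟩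
      b + (1 + q′) * k           ≤⟨ +-monoʳ-≤ b (*-monoˡ-≤ k 1+q′≤q) ⟩
      b + q * k                  ∎

  DGap⇒descends : ∀ r r′ {q q′} → DGap a k (part r q) (part r′ q′) → minDrop r + q′ ≤ q
  DGap⇒descends A r′ {q} {q′} (_ , ≡a⇒k+y<x) =
    *-cancelʳ-< k (suc q′) q (+-cancelˡ-< a _ _ (begin-strict
      a + (k + q′ * k)           ≡⟨ x∙yz≈y∙xz a k (q′ * k) ⟩
      k + (a + q′ * k)           ≤⟨ +-monoʳ-≤ k (+-monoˡ-≤ (q′ * k) (a≤residue r′)) ⟩
      k + part r′ q′             <⟨ ≡a⇒k+y<x (part-≡residue A q) ⟩
      a + q * k                  ∎))
    where open ≤-Reasoning
  DGap⇒descends B r′ {q} {q′} (k+y≤x , _) =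
    *-cancelʳ-< k q′ q (+-cancelˡ-< b _ _ (begin-strict
      b + q′ * k                 ≤⟨ +-monoˡ-≤ (q′ * k) b≤k ⟩
      k + q′ * k                 <⟨ +-monoʳ-< k (m<n+m (q′ * k) (residue-positive r′)) ⟩
      k + part r′ q′             ≤⟨ k+y≤x ⟩
      b + q * k                  ∎))
    where open ≤-Reasoning

  D′-intro : ∀ {ps} → All IsPart ps → Linked (DGap a k) ps → D′ a b k ps
  D′-intro parts gaps =
    (Linked.map DGap⇒≥ gaps , All.map positive parts) , All.map classOf parts , gaps
    where
    DGap⇒≥ : ∀ {x y} → DGap a k x y → x ≥ y
    DGap⇒≥ {x} {y} (k+y≤x , _) = ≤-trans (m≤n+m y k) k+y≤x

    positive : ∀ {x} → IsPart x → 1 ≤ x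
    positive (r , q , refl) = part-positive r q

    classOf : ∀ {x} → IsPart x → (x ≡ a [mod k ]) ⊎ (x ≡ b [mod k ])
    classOf (A , q , refl) = inj₁ (part-≡residue A q)
    classOf (B , q , refl) = inj₂ (part-≡residue B q)

  D′⇒parts : ∀ {ps} → D′ a b k ps → All IsPart ps
  D′⇒parts ((_ , positive) , classes , _) = All.zipWith isPart (positive , classes)
    where
    isPart : ∀ {x} → 1 ≤ x × ((x ≡ a [mod k ]) ⊎ (x ≡ b [mod k ])) → IsPart x
    isPart (0<x , inj₁ x≡a) = ≡residue⇒IsPart A 0<x x≡a
    isPart (0<x , inj₂ x≡b) = ≡residue⇒IsPart B 0<x x≡b

  baseLevel : Tag → List Tag → ℕ
  baseLevel r []        = 0
  baseLevel r (r′ ∷ rs) = minDrop r + baseLevel r′ rs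

  basis : List Tag → List ℕ
  basis []       = []
  basis (r ∷ rs) = part r (baseLevel r rs) ∷ basis rs

  length-basis : ∀ rs → length (basis rs) ≡ length rs
  length-basis []       = refl
  length-basis (r ∷ rs) = cong suc (length-basis rs)

  Basis : List ℕ → Set
  Basis bs = ∃[ rs ] bs ≡ basis rs

  infixl 6 _⊕_
  _⊕_ : List Tag → List ℕ → List ℕ
  rs ⊕ ts = zipWith _+_ (basis rs) (map (_* k) ts)

  ⊕-zeros : ∀ rs → rs ⊕ replicate (length rs) 0 ≡ basis rs
  ⊕-zeros []       = refl
  ⊕-zeros (r ∷ rs) = cong₂ _∷_ (+-identityʳ _) (⊕-zeros rs)

  ⊕-parts : ∀ rs ts → All IsPart (rs ⊕ ts)
  ⊕-parts []       _        = []
  ⊕-parts (_ ∷ _)  []       = []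
  ⊕-parts (r ∷ rs) (t ∷ ts) =
    (r , baseLevel r rs + t , part-+ r (baseLevel r rs) t) ∷ ⊕-parts rs ts

  ⊕-gaps : ∀ rs {ts} → Linked _≥_ ts → Linked (DGap a k) (rs ⊕ ts)
  ⊕-gaps []            _             = []
  ⊕-gaps (_ ∷ _)       []            = []
  ⊕-gaps (_ ∷ [])      [-]           = [-]
  ⊕-gaps (_ ∷ _ ∷ _)   [-]           = [-]
  ⊕-gaps (_ ∷ [])      (_ ∷ _)       = [-]
  ⊕-gaps (r ∷ r′ ∷ rs) {t ∷ t′ ∷ _} (t′≤t ∷ ≥ts) =
    subst₂ (DGap a k) (sym (part-+ r (d + Q′) t)) (sym (part-+ r′ Q′ t′))
           (descends⇒DGap r r′ descends)
      ∷ ⊕-gaps (r′ ∷ rs) ≥ts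
    where
    d = minDrop r
    Q′ = baseLevel r′ rs
    descends : d + (Q′ + t′) ≤ d + Q′ + t
    descends = ≤-trans (≤-reflexive (sym (+-assoc d Q′ t′))) (+-monoʳ-≤ (d + Q′) t′≤t)

  ⊕∈D′ : ∀ rs {ts} → Linked _≥_ ts → D′ a b k (rs ⊕ ts)
  ⊕∈D′ rs {ts} ≥ts = D′-intro (⊕-parts rs ts) (⊕-gaps rs ≥ts)

  ⊕-decomposition : ∀ {x ps} → All IsPart (x ∷ ps) → Linked (DGap a k) (x ∷ ps) →
    ∃₂ λ r rs → ∃₂ λ t ts → length rs ≡ length ps × length ts ≡ length ps ×
      Linked _≥_ (t ∷ ts) × x ∷ ps ≡ (r ∷ rs) ⊕ (t ∷ ts)
  ⊕-decomposition ((r , q , refl) ∷ []) _ =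
    r , [] , q , [] , refl , refl , [-] , cong (_∷ []) (sym (part-+ r 0 q))
  ⊕-decomposition ((r , q , refl) ∷ y∷ps-parts) (x≻y ∷ gaps)
    with ⊕-decomposition y∷ps-parts gaps
  ... | r′ , rs , t′ , ts , |rs| , |ts| , ≥t′∷ts , refl
    with m≤n⇒∃[o]m+o≡n (DGap⇒descends r r′ {q} {baseLevel r′ rs + t′}
                         (subst (DGap a k (part r q)) (part-+ r′ (baseLevel r′ rs) t′) x≻y))
  ... | e , refl =
    r , r′ ∷ rs , t′ + e , t′ ∷ ts , cong suc |rs| , cong suc |ts| ,
    m≤m+n t′ e ∷ ≥t′∷ts , cong (_∷ (r′ ∷ rs) ⊕ (t′ ∷ ts)) head≡
    where
    g = minDrop r
    Q′ = baseLevel r′ rs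
    head≡ : part r (g + (Q′ + t′) + e) ≡ part r (g + Q′) + (t′ + e) * k
    head≡ = begin
      part r (g + (Q′ + t′) + e)  ≡⟨ cong (λ l → part r (l + e)) (+-assoc g Q′ t′) ⟨
      part r (g + Q′ + t′ + e)    ≡⟨ cong (part r) (+-assoc (g + Q′) t′ e) ⟩
      part r (g + Q′ + (t′ + e))  ≡⟨ part-+ r (g + Q′) (t′ + e) ⟨
      part r (g + Q′) + (t′ + e) * k ∎
      where open ≡-Reasoning

  ⊕-injective : ∀ {rs ts rs′ ts′} → length ts ≡ length rs → length rs′ ≡ length rs →
    length ts′ ≡ length rs → rs ⊕ ts ≡ rs′ ⊕ ts′ → rs ≡ rs′ × ts ≡ ts′
  ⊕-injective {[]}    {[]}    {[]}    {[]}    _  _  _  _ = refl , refl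
  ⊕-injective {[]}    {_ ∷ _}                 () _  _  _
  ⊕-injective {[]}    {[]}    {_ ∷ _}         _  () _  _
  ⊕-injective {[]}    {[]}    {[]}    {_ ∷ _} _  _  () _
  ⊕-injective {_ ∷ _} {[]}                    () _  _  _
  ⊕-injective {_ ∷ _} {_ ∷ _} {[]}            _  () _  _
  ⊕-injective {_ ∷ _} {_ ∷ _} {_ ∷ _} {[]}    _  _  () _
  ⊕-injective {r ∷ rs} {t ∷ ts} {r′ ∷ rs′} {t′ ∷ ts′} |ts| |rs′| |ts′| eq
    with ⊕-injective (suc-injective |ts|) (suc-injective |rs′|) (suc-injective |ts′|)
                     (∷-injectiveʳ eq)
  ... | refl , refl
    with part-injective r r′ (baseLevel r rs + t) (baseLevel r′ rs + t′)
           (trans (sym (part-+ r (baseLevel r rs) t))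
                  (trans (∷-injectiveˡ eq) (part-+ r′ (baseLevel r′ rs) t′)))
  ... | refl , Q+t≡Q+t′ = refl , cong (_∷ ts) (+-cancelˡ-≡ (baseLevel r rs) t t′ Q+t≡Q+t′)

  separable : SeparableClass k (D′ a b k)
  separable = record
    { Basis    = Basis
    ; Basis⊆P  = λ { _ (rs , refl) →
        subst (D′ a b k) (⊕-zeros rs) (⊕∈D′ rs (zeros-≥ (length rs))) }
    ; finite   = λ m _ → map basis (tagLists m) , λ { _ (rs , refl) |bs|≡m →
        ∈-map⁺ basis (∈-tagLists (trans (sym (length-basis rs)) |bs|≡m)) }
    ; decompose = decompose
    ; unique   = unique
    ; closed   = closed
    }
    where
    length-multiples : ∀ ts rs → length (map (_* k) ts) ≡ length (basis rs) → length ts ≡ length rs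
    length-multiples ts rs eq = trans (sym (length-map (_* k) ts)) (trans eq (length-basis rs))

    decompose : ∀ ps → D′ a b k ps → 1 ≤ length ps →
      Σ (List ℕ) λ bs → Σ (List ℕ) λ πs →
        Basis bs × KMultSeq k πs × length bs ≡ length ps ×
        length πs ≡ length ps × ps ≡ zipWith _+_ bs πs
    decompose (x ∷ ps) x∷ps∈D′ _
      with ⊕-decomposition (D′⇒parts x∷ps∈D′) (proj₂ (proj₂ x∷ps∈D′))
    ... | r , rs , t , ts , |rs| , |ts| , ≥ts , eq =
      basis (r ∷ rs) , map (_* k) (t ∷ ts) , (r ∷ rs , refl) , multiples⇒KMultSeq ≥ts ,
      trans (length-basis (r ∷ rs)) (cong suc |rs|) ,
      trans (length-map (_* k) (t ∷ ts)) (cong suc |ts|) , eq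

    unique : ∀ bs πs bs′ πs′ → Basis bs → Basis bs′ →
      KMultSeq k πs → KMultSeq k πs′ → 1 ≤ length bs →
      length πs ≡ length bs → length bs′ ≡ length bs → length πs′ ≡ length bs →
      zipWith _+_ bs πs ≡ zipWith _+_ bs′ πs′ → bs ≡ bs′ × πs ≡ πs′
    unique _ _ _ _ (rs , refl) (rs′ , refl) kπs kπs′ _ |πs| |bs′| |πs′| eq
      with KMultSeq⇒multiples kπs | KMultSeq⇒multiples kπs′
    ... | ts , refl , _ | ts′ , refl , _
      with ⊕-injective (length-multiples ts rs |πs|)
             (trans (sym (length-basis rs′)) (trans |bs′| (length-basis rs)))
             (length-multiples ts′ rs |πs′|) eq
    ... | refl , refl = refl , refl

    closed : ∀ bs πs → Basis bs → KMultSeq k πs → 1 ≤ length bs →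
      length πs ≡ length bs → D′ a b k (zipWith _+_ bs πs)
    closed _ _ (rs , refl) kπs _ _ with KMultSeq⇒multiples kπs
    ... | ts , refl , ≥ts = ⊕∈D′ rs ≥ts

mainTheorem17 : (a b k : ℕ) → 1 ≤ a → a < b → b ≤ k →
    SeparableClass k (D′ a b k)
mainTheorem17 a b k 1≤a a<b b≤k = SeparableD′.separable 1≤a a<b b≤k
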